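{- Let $K_{n_1,\dots,n_t}$ be a complete multipartite graph with class sizes $n_1\le\dots\le n_t$ and suppose $n_1<t$. Let $j$ be the largest integer such that $n_1+\dots+n_j\le t-j$. Then $\chi_1(K_{n_1,\dots,n_t})\le t-j$.
   Context: $K_{n_1,\dots,n_t}$ denotes the complete $t$-partite graph with vertex classes of sizes $n_1,\dots,n_t$ in which two vertices are adjacent iff they lie in different classes. A 1-selection of a graph $G=(V,E)$ is a map $f$ assigning to each vertex $v$ a set $f(v)$ of at most one edge incident with $v$; the 1-removed subgraph $G_f$ has vertex set $V$ and edge set $E\setminus\bigcup_v f(v)$. The robust chromatic number is $\chi_1(G)=\min_f\chi(G_f)$ over all 1-selections $f$. -}

module Defs where

open import Data.Nat using (ℕ; zero; suc; _+_)
open import Data.Fin using (Fin; zero; suc)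
open import Data.Maybe using (Maybe; just; nothing)
open import Data.Product using (Σ; _×_)
open import Relation.Binary.PropositionalEquality using (_≡_; _≢_)
open import Relation.Nullary using (¬_)

record Graph : Set₁ where
  field
    V   : Set
    Adj : V → V → Set

open Graph public

completeMultipartite : (t : ℕ) → (Fin t → ℕ) → Graph
completeMultipartite t ns = record
  { V   = Σ (Fin t) (λ i → Fin (ns i))
  ; Adj = λ u v → Σ.proj₁ u ≢ Σ.proj₁ v
  }
  where open Σ

-- A 1-selection: each vertex v selects at most one incident edge, encoded as
-- the other endpoint (nothing = no edge selected).
record OneSelection (G : Graph) : Set where
  field
    sel     : V G → Maybe (V G)
    sel-inc : ∀ v w → sel v ≡ just w → Adj G v w

open OneSelection public

removed : (G : Graph) → OneSelection G → Graph
removed G f = record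
  { V   = V G
  ; Adj = λ u w → Adj G u w × (¬ (sel f u ≡ just w)) × (¬ (sel f w ≡ just u))
  }

Colourable : Graph → ℕ → Set
Colourable G k = Σ (V G → Fin k) (λ c → ∀ u w → Adj G u w → c u ≢ c w)

-- χ_1(G) ≤ k  (unfolding of  min_f χ(G_f) ≤ k).
χ₁≤ : Graph → ℕ → Set
χ₁≤ G k = Σ (OneSelection G) (λ f → Colourable (removed G f) k)

-- prefixSum ns j = n_1 + ... + n_j (ns indexed from 0; j capped at t).
prefixSum : ∀ {t} → (Fin t → ℕ) → ℕ → ℕ
prefixSum {zero}  ns j       = 0
prefixSum {suc t} ns zero    = 0
prefixSum {suc t} ns (suc j) = ns zero + prefixSum (λ i → ns (suc i)) j

-- Number the vertices of the first j classes consecutively, class by class; by hypothesis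
-- there are at most t − j of them, so they can all receive distinct colours 0, …, t − j − 1.
-- Every later class k (k ≥ j) is coloured k − j. The only monochromatic edges then join the
-- early vertex numbered k − j to the vertices of class k, and each vertex of class k removes
-- exactly that edge with its 1-selection.
module Submission where

open import Defs
open import Data.Nat using (ℕ; zero; suc; _≤_; _<_; _∸_; _+_; s≤s; _<?_)
open import Data.Nat.Properties
  using (≤-trans; <-≤-trans; m≤m+n; +-monoʳ-<; m+n≮m; m+n∸m≡n; ≮⇒≥; <-irrefl; ∸-monoˡ-<; ∸-cancelʳ-≡)
open import Data.Fin using (Fin; zero; suc; toℕ; fromℕ<; _≟_)
open import Data.Fin.Properties using (toℕ<n; toℕ-injective; fromℕ<-toℕ; fromℕ<-injective)
open import Data.Product using (Σ; _,_; proj₁)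
open import Data.Maybe using (Maybe; just; nothing; map)
open import Data.Maybe.Properties using (just-injective)
open import Data.Empty using (⊥-elim)
open import Function using (_∘_)
open import Relation.Nullary using (¬_; Dec; yes; no)
open import Relation.Binary.PropositionalEquality using (_≡_; _≢_; refl; sym; trans; cong)

Vertex : ∀ {t} → (Fin t → ℕ) → Set
Vertex ns = Σ _ (λ i → Fin (ns i))

position : ∀ {t} (ns : Fin t → ℕ) → Vertex ns → ℕ
position ns (zero  , a) = toℕ a
position ns (suc i , a) = ns zero + position (ns ∘ suc) (i , a)

position<prefixSum : ∀ {t} (ns : Fin t → ℕ) {j} (v : Vertex ns)
  → toℕ (proj₁ v) < j → position ns v < prefixSum ns j
position<prefixSum {suc t} ns {suc j} (zero  , a) _        = ≤-trans (toℕ<n a) (m≤m+n _ _)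
position<prefixSum {suc t} ns {suc j} (suc i , a) (s≤s lt) =
  +-monoʳ-< (ns zero) (position<prefixSum (ns ∘ suc) (i , a) lt)

vertexAt : ∀ {t} (ns : Fin t → ℕ) → ℕ → Maybe (Vertex ns)
vertexAt {zero}  ns p = nothing
vertexAt {suc t} ns p with p <? ns zero
... | yes p<n = just (zero , fromℕ< p<n)
... | no  _   = map (λ { (i , a) → suc i , a }) (vertexAt (ns ∘ suc) (p ∸ ns zero))

vertexAt-position : ∀ {t} (ns : Fin t → ℕ) (v : Vertex ns) → vertexAt ns (position ns v) ≡ just v
vertexAt-position {suc t} ns (zero , a) with toℕ a <? ns zero
... | yes lt = cong (λ b → just (zero , b)) (fromℕ<-toℕ a lt)
... | no ¬lt = ⊥-elim (¬lt (toℕ<n a))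
vertexAt-position {suc t} ns (suc i , a) with ns zero + position (ns ∘ suc) (i , a) <? ns zero
... | yes lt = ⊥-elim (m+n≮m _ _ lt)
... | no  _
  rewrite m+n∸m≡n (ns zero) (position (ns ∘ suc) (i , a))
        | vertexAt-position (ns ∘ suc) (i , a) = refl

position-injective : ∀ {t} (ns : Fin t → ℕ) {u v : Vertex ns} → position ns u ≡ position ns v → u ≡ v
position-injective ns {u} {v} eq = just-injective (trans (sym (vertexAt-position ns u))
  (trans (cong (vertexAt ns) eq) (vertexAt-position ns v)))

module _ {t} {ns : Fin t → ℕ} where

  outsideClass : Fin t → Maybe (Vertex ns) → Maybe (Vertex ns)
  outsideClass k nothing        = nothing
  outsideClass k (just (i , a)) with i ≟ k
  ... | yes _ = nothing
  ... | no  _ = just (i , a)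

  outsideClass-≢ : ∀ k m w → outsideClass k m ≡ just w → k ≢ proj₁ w
  outsideClass-≢ k (just (i , a)) w eq with i ≟ k
  outsideClass-≢ k (just (i , a)) .(i , a) refl | no i≢k = i≢k ∘ sym

  outsideClass-just : ∀ k (v : Vertex ns) → proj₁ v ≢ k → outsideClass k (just v) ≡ just v
  outsideClass-just k (i , a) i≢k with i ≟ k
  ... | yes i≡k = ⊥-elim (i≢k i≡k)
  ... | no  _   = refl

module _ {t} (ns : Fin t → ℕ) (j : ℕ) (room : prefixSum ns j ≤ t ∸ j) where

  selection : OneSelection (completeMultipartite t ns)
  sel     selection (k , _) = outsideClass k (vertexAt ns (toℕ k ∸ j))
  sel-inc selection (k , _) = outsideClass-≢ k (vertexAt ns (toℕ k ∸ j))

  selection-removes : ∀ u {k} b → toℕ (proj₁ u) < j → j ≤ toℕ k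
    → position ns u ≡ toℕ k ∸ j → sel selection (k , b) ≡ just u
  selection-removes u {k} b early late eq
    rewrite sym eq | vertexAt-position ns u =
    outsideClass-just k u (λ { refl → <-irrefl refl (<-≤-trans early late) })

  colourFor : (v : Vertex ns) → Dec (toℕ (proj₁ v) < j) → Fin (t ∸ j)
  colourFor v       (yes early) = fromℕ< (<-≤-trans (position<prefixSum ns v early) room)
  colourFor (i , a) (no  late)  = fromℕ< (∸-monoˡ-< (toℕ<n i) (≮⇒≥ late))

  colour : Vertex ns → Fin (t ∸ j)
  colour v = colourFor v (toℕ (proj₁ v) <? j)

  earlyLate-colour-≢ : ∀ u {k} b (early : toℕ (proj₁ u) < j) (late : ¬ toℕ k < j)
    → ¬ sel selection (k , b) ≡ just u → colourFor u (yes early) ≢ colourFor (k , b) (no late)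
  earlyLate-colour-≢ u b early late unselected eq =
    unselected (selection-removes u b early (≮⇒≥ late) (fromℕ<-injective _ _ _ _ eq))

  colourFor-proper : ∀ u w → proj₁ u ≢ proj₁ w
    → ¬ sel selection u ≡ just w → ¬ sel selection w ≡ just u
    → (du : Dec (toℕ (proj₁ u) < j)) (dw : Dec (toℕ (proj₁ w) < j)) → colourFor u du ≢ colourFor w dw
  colourFor-proper u w ≢class _ _ (yes _) (yes _) eq =
    ≢class (cong proj₁ (position-injective ns (fromℕ<-injective _ _ _ _ eq)))
  colourFor-proper (i , _) (k , _) ≢class _ _ (no late-i) (no late-k) eq =
    ≢class (toℕ-injective (∸-cancelʳ-≡ (≮⇒≥ late-i) (≮⇒≥ late-k) (fromℕ<-injective _ _ _ _ eq)))
  colourFor-proper u (_ , b) _ _ w↛u (yes early) (no late) = earlyLate-colour-≢ u b early late w↛u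
  colourFor-proper (_ , a) w _ u↛w _ (no late) (yes early) = earlyLate-colour-≢ w a early late u↛w ∘ sym

  χ₁≤-completeMultipartite : χ₁≤ (completeMultipartite t ns) (t ∸ j)
  χ₁≤-completeMultipartite = selection , colour , λ u w (≢class , u↛w , w↛u) →
    colourFor-proper u w ≢class u↛w w↛u (toℕ (proj₁ u) <? j) (toℕ (proj₁ w) <? j)

corollary3p2 : (m : ℕ) (ns : Fin (suc m) → ℕ)
    → (∀ i → 1 ≤ ns i)
    → (∀ i k → toℕ i ≤ toℕ k → ns i ≤ ns k)
    → ns zero < suc m
    → (j : ℕ) → j ≤ suc m
    → prefixSum ns j ≤ suc m ∸ j
    → (∀ j′ → j < j′ → j′ ≤ suc m → ¬ (prefixSum ns j′ ≤ suc m ∸ j′))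
    → χ₁≤ (completeMultipartite (suc m) ns) (suc m ∸ j)
corollary3p2 m ns _ _ _ j _ room _ = χ₁≤-completeMultipartite ns j room
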